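{- Let $n = 2^m$ with $m \geq 2$, $N = n/2$, and let $H$ be the subgroup (under $\Delta$) of the power set of $\{1,\dots,N-1\}$ generated by $\{\{j, 2^{i-1}+j\} : j = 1, \dots, 2^{i-1}-1,\ i = 2, \dots, m-1\}$. For $i = 1, \dots, n/4$ let $M_i'$ be the set of all edges of $Q_n$ of the forms $\big(A\Delta\langle 2i-2\rangle\Delta\langle r-1\rangle\Delta\theta(\langle 2i-2\rangle\Delta\langle N-r+2i-1\rangle\Delta B),\ A\Delta\langle 2i-2\rangle\Delta\langle r-1\rangle\Delta\theta(\langle 2i-2\rangle\Delta\langle N-r+2i\rangle\Delta B)\big)$ and $\big(A\Delta\langle 2i-2\rangle\Delta\overline{\langle r-1\rangle}\Delta\theta(\langle 2i-2\rangle\Delta\overline{\langle N-r+2i-1\rangle}\Delta B),\ A\Delta\langle 2i-2\rangle\Delta\overline{\langle r-1\rangle}\Delta\theta(\langle 2i-2\rangle\Delta\overline{\langle N-r+2i\rangle}\Delta B)\big)$, where $A, B \in H$ and $r \in \{2i-1, 2i, \dots, N+2i-2\}$. Then $M' = M_1' \cup M_2' \cup \dots \cup M_{n/4}'$ is a matching in $Q_n$.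
   Context: Vertices of $Q_n$ are subsets of $\{1,\dots,n\}$, adjacent iff their symmetric difference $\Delta$ has one element. With $N = n/2$: $\langle 0\rangle = \emptyset$; $\langle i\rangle = \{1, \dots, i\}$ for $1 \le i \le N$; $\langle N+i\rangle = \{i+1, \dots, N\}$ for $1 \le i \le N$. For $X \subseteq \{1,\dots,N\}$, $\overline{X} = \{1,\dots,N\}\setminus X$. $\theta(i) = i+N$ and $\theta(X) = \{\theta(x): x\in X\}$, $\theta(\emptyset)=\emptyset$. -}

module Defs where

open import Data.Nat using (ℕ; zero; suc; _+_; _*_; _∸_; _^_; _≤_; _≤ᵇ_; _<ᵇ_; _≡ᵇ_)
open import Data.Bool using (Bool; true; false; _∧_; _xor_; not; if_then_else_)
open import Data.Fin using (Fin; toℕ)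
open import Data.Vec using (Vec; []; _∷_; tabulate; zipWith; replicate)
open import Data.Fin.Subset using (Subset; ∣_∣)
open import Data.Product using (Σ; _×_; ∃-syntax)
open import Data.Sum using (_⊎_)
open import Relation.Binary.PropositionalEquality using (_≡_)

-- Elements of {1,…,k} are represented by Fin k, index i ↦ element (toℕ i + 1).
-- A vertex of Q_n is a Subset n (= Vec Bool n).

memℕ : ∀ {k} → Subset k → ℕ → Bool
memℕ []       _             = false
memℕ (b ∷ v)  zero          = false
memℕ (b ∷ v)  (suc zero)    = b
memℕ (b ∷ v)  (suc (suc y)) = memℕ v (suc y)

fromPred : ∀ {k} → (ℕ → Bool) → Subset k
fromPred p = tabulate (λ i → p (suc (toℕ i)))

_Δ_ : ∀ {k} → Subset k → Subset k → Subset k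
_Δ_ = zipWith _xor_

infixl 6 _Δ_

nOf : ℕ → ℕ
nOf m = 2 ^ m

NOf : ℕ → ℕ
NOf m = 2 ^ (m ∸ 1)

-- ⟨k⟩ : ⟨0⟩ = ∅, ⟨i⟩ = {1..i} (1 ≤ i ≤ N), ⟨N+i⟩ = {i+1..N} (1 ≤ i ≤ N)
br : (m : ℕ) → ℕ → Subset (nOf m)
br m k = fromPred (λ x → if k ≤ᵇ NOf m
                          then (1 ≤ᵇ x) ∧ (x ≤ᵇ k)
                          else ((k ∸ NOf m) <ᵇ x) ∧ (x ≤ᵇ NOf m))

cbar : (m : ℕ) → Subset (nOf m) → Subset (nOf m)
cbar m X = fromPred (λ x → (1 ≤ᵇ x) ∧ (x ≤ᵇ NOf m) ∧ not (memℕ X x))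

θ : (m : ℕ) → Subset (nOf m) → Subset (nOf m)
θ m X = fromPred (λ x → (NOf m <ᵇ x) ∧ memℕ X (x ∸ NOf m))

gen : (m i j : ℕ) → Subset (nOf m)
gen m i j = fromPred (λ x → (x ≡ᵇ j) xor (x ≡ᵇ 2 ^ (i ∸ 1) + j))

data InH (m : ℕ) : Subset (nOf m) → Set where
  h-empty : InH m (replicate _ false)
  h-step  : ∀ {A} (i j : ℕ) → 2 ≤ i → i ≤ m ∸ 1 → 1 ≤ j → j ≤ 2 ^ (i ∸ 1) ∸ 1 →
            InH m A → InH m (gen m i j Δ A)

Adj : ∀ {k} → Subset k → Subset k → Set
Adj u v = ∣ u Δ v ∣ ≡ 1

form1 : (m i r : ℕ) → (A B : Subset (nOf m)) → ℕ → Subset (nOf m)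
form1 m i r A B s =
  A Δ br m (2 * i ∸ 2) Δ br m (r ∸ 1)
    Δ θ m (br m (2 * i ∸ 2) Δ br m (NOf m + 2 * i ∸ s ∸ r) Δ B)

form2 : (m i r : ℕ) → (A B : Subset (nOf m)) → ℕ → Subset (nOf m)
form2 m i r A B s =
  A Δ br m (2 * i ∸ 2) Δ cbar m (br m (r ∸ 1))
    Δ θ m (br m (2 * i ∸ 2) Δ cbar m (br m (NOf m + 2 * i ∸ s ∸ r)) Δ B)

InMi : (m i : ℕ) → Subset (nOf m) → Subset (nOf m) → Set
InMi m i u v =
  Adj u v ×
  ∃[ A ] ∃[ B ] ∃[ r ] (InH m A × InH m B ×
     (2 * i ∸ 1 ≤ r) × (r ≤ NOf m + 2 * i ∸ 2) ×
     ((u ≡ form1 m i r A B 1 × v ≡ form1 m i r A B 0) ⊎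
      (u ≡ form2 m i r A B 1 × v ≡ form2 m i r A B 0)))

InM' : (m : ℕ) → Subset (nOf m) → Subset (nOf m) → Set
InM' m u v = ∃[ i ] ((1 ≤ i) × (i ≤ 2 ^ (m ∸ 2)) × InMi m i u v)

IsMatching : (m : ℕ) → Set
IsMatching m = ∀ u v u' v' → InM' m u v → InM' m u' v' →
  (u ≡ u' ⊎ u ≡ v' ⊎ v ≡ u' ⊎ v ≡ v') →
  (u ≡ u' × v ≡ v') ⊎ (u ≡ v' × v ≡ u')

module Submission where

open import Defs
open import Data.Bool using (Bool; true; false; _∧_; _xor_; not; if_then_else_; T)
open import Data.Bool.Properties
  using ( xor-assoc; xor-comm; xor-same; xor-identityʳ; xor-annihilates-not; not-injective
        ; ∧-identityʳ; ∧-zeroʳ; ∧-distribˡ-xor; T-≡ )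
open import Data.Bool.Solver using (module xor-∧-Solver)
open import Data.Empty using (⊥)
open import Data.Fin.Subset using (Subset)
open import Data.Nat
  using (ℕ; zero; suc; _+_; _*_; _∸_; _^_; _<_; _≤_; z≤n; s≤s; z<s; ⌊_/2⌋; _≤ᵇ_; _<ᵇ_; _≡ᵇ_)
open import Data.Nat.Properties
open import Data.Nat.Tactic.RingSolver using (solve-∀)
open import Data.Product using (_×_; _,_; proj₁; proj₂)
open import Data.Sum using (_⊎_; inj₁; inj₂)
open import Data.Vec using ([]; _∷_; replicate)
open import Data.Vec.Properties using (zipWith-assoc)
open import Function using (_∘_; Equivalence)
open import Relation.Binary.PropositionalEquality
open import Relation.Nullary using (yes; no; contradiction)

-- For S ⊆ {1,…,2N} and b < M (N = 2^M) let μ 0 S b and μ N S b be the parities of the numbers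
-- of multiples of 2^b among the x ∈ {1,…,N} with x ∈ S, resp. N + x ∈ S. Both are Δ-linear and
-- vanish on H (a generator pairs j with 2^(i-1) + j, which have the same divisibility by 2^b);
-- θ(X) is invisible to μ 0 and μ N (θ X) = μ 0 X; ⟨k⟩ and its complement lie in the lower
-- half, where μ 0 reads off the binary digits of k. Hence an endpoint of the edge of M'_i with
-- r = 2i - 1 + L has invariants (p ⊕ (p + L), p ⊕ (N - L + δ)), where p = 2i - 2 is even and
-- δ ∈ {0,1} tells which endpoint it is. Since (p + L) + (N - L + δ) ≡ p + δ modulo N, a carry
-- analysis shows that these bit strings determine L. The other endpoint is obtained from
-- either one by Δ with θ(⟨N - L⟩ Δ ⟨N - L + 1⟩), so two edges of M' with a common vertex
-- coincide.

-- Binary digits and addition with carry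

fromBool : Bool → ℕ
fromBool false = 0
fromBool true  = 1

odd : ℕ → Bool
odd zero          = false
odd (suc zero)    = true
odd (suc (suc n)) = odd n

testBit : ℕ → ℕ → Bool
testBit x zero    = odd x
testBit x (suc b) = testBit ⌊ x /2⌋ b

infixr 5 _∷ᵇ_

_∷ᵇ_ : Bool → ℕ → ℕ
a ∷ᵇ u = fromBool a + (u + u)

∷ᵇ-suc : ∀ a u → a ∷ᵇ suc u ≡ 2 + (a ∷ᵇ u)
∷ᵇ-suc a u = expand (fromBool a) u
  where
  expand : ∀ α u → α + (suc u + suc u) ≡ 2 + (α + (u + u))
  expand = solve-∀

odd-∷ᵇ : ∀ a u → odd (a ∷ᵇ u) ≡ a
odd-∷ᵇ false zero    = refl
odd-∷ᵇ true  zero    = refl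
odd-∷ᵇ a     (suc u) = trans (cong odd (∷ᵇ-suc a u)) (odd-∷ᵇ a u)

⌊∷ᵇ/2⌋ : ∀ a u → ⌊ a ∷ᵇ u /2⌋ ≡ u
⌊∷ᵇ/2⌋ false zero    = refl
⌊∷ᵇ/2⌋ true  zero    = refl
⌊∷ᵇ/2⌋ a     (suc u) = trans (cong ⌊_/2⌋ (∷ᵇ-suc a u)) (cong suc (⌊∷ᵇ/2⌋ a u))

odd∷ᵇ⌊/2⌋ : ∀ x → odd x ∷ᵇ ⌊ x /2⌋ ≡ x
odd∷ᵇ⌊/2⌋ zero          = refl
odd∷ᵇ⌊/2⌋ (suc zero)    = refl
odd∷ᵇ⌊/2⌋ (suc (suc x)) = trans (∷ᵇ-suc (odd x) ⌊ x /2⌋) (cong (2 +_) (odd∷ᵇ⌊/2⌋ x))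

carry : Bool → Bool → Bool → Bool
carry true  true  _ = true
carry false false _ = false
carry _     _     c = c

full-adder : ∀ a b c → fromBool a + fromBool b + fromBool c ≡ (a xor b xor c) ∷ᵇ fromBool (carry a b c)
full-adder false false false = refl
full-adder false false true  = refl
full-adder false true  false = refl
full-adder false true  true  = refl
full-adder true  false false = refl
full-adder true  false true  = refl
full-adder true  true  false = refl
full-adder true  true  true  = refl

∷ᵇ-+-∷ᵇ : ∀ a b c u v →
          (a ∷ᵇ u) + (b ∷ᵇ v) + fromBool c ≡ (a xor b xor c) ∷ᵇ (u + v + fromBool (carry a b c))
∷ᵇ-+-∷ᵇ a b c u v = begin
  (fromBool a + (u + u)) + (fromBool b + (v + v)) + fromBool c
    ≡⟨ regroup (fromBool a) (fromBool b) (fromBool c) u v ⟩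
  (fromBool a + fromBool b + fromBool c) + ((u + v) + (u + v))
    ≡⟨ cong (_+ ((u + v) + (u + v))) (full-adder a b c) ⟩
  (fromBool (a xor b xor c) + (k + k)) + ((u + v) + (u + v))
    ≡⟨ absorb (fromBool (a xor b xor c)) k (u + v) ⟩
  fromBool (a xor b xor c) + ((u + v + k) + (u + v + k)) ∎
  where
  open ≡-Reasoning
  k = fromBool (carry a b c)
  regroup : ∀ α β γ u v → (α + (u + u)) + (β + (v + v)) + γ ≡ (α + β + γ) + ((u + v) + (u + v))
  regroup = solve-∀
  absorb : ∀ α k w → (α + (k + k)) + (w + w) ≡ α + ((w + k) + (w + k))
  absorb = solve-∀

halfSum : ℕ → ℕ → Bool → ℕ
halfSum x y c = ⌊ x /2⌋ + ⌊ y /2⌋ + fromBool (carry (odd x) (odd y) c)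

+-as-∷ᵇ : ∀ x y c → x + y + fromBool c ≡ (odd x xor odd y xor c) ∷ᵇ halfSum x y c
+-as-∷ᵇ x y c = begin
  x + y + fromBool c
    ≡⟨ cong₂ (λ x y → x + y + fromBool c) (sym (odd∷ᵇ⌊/2⌋ x)) (sym (odd∷ᵇ⌊/2⌋ y)) ⟩
  (odd x ∷ᵇ ⌊ x /2⌋) + (odd y ∷ᵇ ⌊ y /2⌋) + fromBool c
    ≡⟨ ∷ᵇ-+-∷ᵇ (odd x) (odd y) c ⌊ x /2⌋ ⌊ y /2⌋ ⟩
  (odd x xor odd y xor c) ∷ᵇ halfSum x y c ∎
  where open ≡-Reasoning

odd-+ : ∀ x y c → odd (x + y + fromBool c) ≡ odd x xor odd y xor c
odd-+ x y c = trans (cong odd (+-as-∷ᵇ x y c)) (odd-∷ᵇ (odd x xor odd y xor c) (halfSum x y c))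

⌊+/2⌋ : ∀ x y c → ⌊ x + y + fromBool c /2⌋ ≡ halfSum x y c
⌊+/2⌋ x y c = trans (cong ⌊_/2⌋ (+-as-∷ᵇ x y c)) (⌊∷ᵇ/2⌋ (odd x xor odd y xor c) (halfSum x y c))

odd-+carry : ∀ x c → odd (x + fromBool c) ≡ odd x xor c
odd-+carry x c = trans (cong (λ x → odd (x + fromBool c)) (sym (+-identityʳ x))) (odd-+ x 0 c)

⌊+carry/2⌋ : ∀ x c → ⌊ x + fromBool c /2⌋ ≡ ⌊ x /2⌋ + fromBool (odd x ∧ c)
⌊+carry/2⌋ x c = begin
  ⌊ x + fromBool c /2⌋
    ≡⟨ cong (λ x → ⌊ x + fromBool c /2⌋) (sym (+-identityʳ x)) ⟩
  ⌊ x + 0 + fromBool c /2⌋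
    ≡⟨ ⌊+/2⌋ x 0 c ⟩
  ⌊ x /2⌋ + 0 + fromBool (carry (odd x) false c)
    ≡⟨ cong₂ (λ u k → u + fromBool k) (+-identityʳ ⌊ x /2⌋) (carry-false (odd x)) ⟩
  ⌊ x /2⌋ + fromBool (odd x ∧ c) ∎
  where
  open ≡-Reasoning
  carry-false : ∀ a → carry a false c ≡ a ∧ c
  carry-false false = refl
  carry-false true  = refl

2^suc+-as-∷ᵇ : ∀ a x → 2 ^ suc a + x ≡ odd x ∷ᵇ (2 ^ a + ⌊ x /2⌋)
2^suc+-as-∷ᵇ a x = trans (cong (2 ^ suc a +_) (sym (odd∷ᵇ⌊/2⌋ x))) (shuffle (2 ^ a) (fromBool (odd x)) ⌊ x /2⌋)
  where
  shuffle : ∀ k α h → 2 * k + (α + (h + h)) ≡ α + ((k + h) + (k + h))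
  shuffle = solve-∀

testBit-2^+ : ∀ M x {b} → b < M → testBit (2 ^ M + x) b ≡ testBit x b
testBit-2^+ (suc M) x {zero}  _         = trans (cong odd (2^suc+-as-∷ᵇ M x)) (odd-∷ᵇ (odd x) (2 ^ M + ⌊ x /2⌋))
testBit-2^+ (suc M) x {suc b} (s≤s b<M) = trans (cong (λ y → testBit y b) halve) (testBit-2^+ M ⌊ x /2⌋ b<M)
  where
  halve : ⌊ 2 ^ suc M + x /2⌋ ≡ 2 ^ M + ⌊ x /2⌋
  halve = trans (cong ⌊_/2⌋ (2^suc+-as-∷ᵇ M x)) (⌊∷ᵇ/2⌋ (odd x) (2 ^ M + ⌊ x /2⌋))

testBit-0 : ∀ b → testBit 0 b ≡ false
testBit-0 zero    = refl
testBit-0 (suc b) = testBit-0 b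

testBit-2^ : ∀ M {b} → b < M → testBit (2 ^ M) b ≡ false
testBit-2^ M {b} b<M = begin
  testBit (2 ^ M) b       ≡⟨ cong (λ y → testBit y b) (sym (+-identityʳ (2 ^ M))) ⟩
  testBit (2 ^ M + 0) b   ≡⟨ testBit-2^+ M 0 b<M ⟩
  testBit 0 b             ≡⟨ testBit-0 b ⟩
  false                   ∎
  where open ≡-Reasoning

infixl 6 _⊕_

_⊕_ : (ℕ → Bool) → (ℕ → Bool) → ℕ → Bool
(f ⊕ g) b = f b xor g b

AgreeBelow : ℕ → (ℕ → Bool) → (ℕ → Bool) → Set
AgreeBelow M f g = ∀ b → b < M → f b ≡ g b

module _ {M : ℕ} {f g : ℕ → Bool} where

  agree-head : AgreeBelow (suc M) f g → f 0 ≡ g 0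
  agree-head f≈g = f≈g 0 z<s

  agree-tail : AgreeBelow (suc M) f g → AgreeBelow M (f ∘ suc) (g ∘ suc)
  agree-tail f≈g b b<M = f≈g (suc b) (s≤s b<M)

  agree-cons : f 0 ≡ g 0 → AgreeBelow M (f ∘ suc) (g ∘ suc) → AgreeBelow (suc M) f g
  agree-cons f0≡g0 _    zero    _         = f0≡g0
  agree-cons _     tail (suc b) (s≤s b<M) = tail b b<M

half-< : ∀ {h k} → h + h < k + k → h < k
half-< {h} {k} lt with h <? k
... | yes h<k = h<k
... | no  h≮k = contradiction (+-mono-≤ (≮⇒≥ h≮k) (≮⇒≥ h≮k)) (<⇒≱ lt)

⌊/2⌋-<-2^ : ∀ M {x} → x < 2 ^ suc M → ⌊ x /2⌋ < 2 ^ M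
⌊/2⌋-<-2^ M {x} x<2^sM = half-< (begin-strict
  ⌊ x /2⌋ + ⌊ x /2⌋     ≤⟨ m≤n+m _ (fromBool (odd x)) ⟩
  odd x ∷ᵇ ⌊ x /2⌋      ≡⟨ odd∷ᵇ⌊/2⌋ x ⟩
  x                     <⟨ x<2^sM ⟩
  2 * 2 ^ M             ≡⟨ cong (2 ^ M +_) (+-identityʳ (2 ^ M)) ⟩
  2 ^ M + 2 ^ M         ∎)
  where open ≤-Reasoning

testBit-injective : ∀ M {x y} → x < 2 ^ M → y < 2 ^ M → AgreeBelow M (testBit x) (testBit y) → x ≡ y
testBit-injective zero    {zero} {zero}  _        _        _   = refl
testBit-injective zero    {suc _}        (s≤s ()) _        _
testBit-injective zero    {zero} {suc _} _        (s≤s ()) _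
testBit-injective (suc M) {x}    {y}     x<2^M    y<2^M    x≈y = begin
  x                  ≡⟨ sym (odd∷ᵇ⌊/2⌋ x) ⟩
  odd x ∷ᵇ ⌊ x /2⌋   ≡⟨ cong₂ _∷ᵇ_ (agree-head x≈y) halves-equal ⟩
  odd y ∷ᵇ ⌊ y /2⌋   ≡⟨ odd∷ᵇ⌊/2⌋ y ⟩
  y                  ∎
  where
  open ≡-Reasoning
  halves-equal : ⌊ x /2⌋ ≡ ⌊ y /2⌋
  halves-equal = testBit-injective M (⌊/2⌋-<-2^ M x<2^M) (⌊/2⌋-<-2^ M y<2^M) (agree-tail x≈y)

infix 7 2^_∣ᵇ_

2^_∣ᵇ_ : ℕ → ℕ → Bool
2^ zero  ∣ᵇ x = true
2^ suc b ∣ᵇ x = not (odd x) ∧ 2^ b ∣ᵇ ⌊ x /2⌋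

odd-suc : ∀ K → odd (suc K) ≡ not (odd K)
odd-suc zero          = refl
odd-suc (suc zero)    = refl
odd-suc (suc (suc K)) = odd-suc K

⌊suc/2⌋ : ∀ K → ⌊ suc K /2⌋ ≡ ⌊ K /2⌋ + fromBool (odd K)
⌊suc/2⌋ zero          = refl
⌊suc/2⌋ (suc zero)    = refl
⌊suc/2⌋ (suc (suc K)) = cong suc (⌊suc/2⌋ K)

testBit-suc : ∀ K b → testBit (suc K) b ≡ testBit K b xor 2^ b ∣ᵇ suc K
testBit-suc K zero = trans (odd-suc K) (sym (xor-true (odd K)))
  where
  xor-true : ∀ x → x xor true ≡ not x
  xor-true false = refl
  xor-true true  = refl
testBit-suc K (suc b) rewrite ⌊suc/2⌋ K | odd-suc K with odd K
... | true  rewrite +-comm ⌊ K /2⌋ 1 = testBit-suc ⌊ K /2⌋ b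
... | false = trans (cong (λ y → testBit y b) (+-identityʳ ⌊ K /2⌋)) (sym (xor-identityʳ (testBit ⌊ K /2⌋ b)))

2^∣ᵇ-2^+ : ∀ b a {j} → 1 ≤ j → j < 2 ^ a → 2^ b ∣ᵇ (2 ^ a + j) ≡ 2^ b ∣ᵇ j
2^∣ᵇ-2^+ zero    _       _       _        = refl
2^∣ᵇ-2^+ (suc b) zero    (s≤s _) (s≤s ())
2^∣ᵇ-2^+ (suc b) (suc a) {j} 1≤j j<2^sa
  rewrite 2^suc+-as-∷ᵇ a j | odd-∷ᵇ (odd j) (2 ^ a + ⌊ j /2⌋) | ⌊∷ᵇ/2⌋ (odd j) (2 ^ a + ⌊ j /2⌋)
  with odd j in odd-j
... | true  = refl
... | false = 2^∣ᵇ-2^+ b a half-positive (⌊/2⌋-<-2^ a j<2^sa)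
  where
  half-positive : 1 ≤ ⌊ j /2⌋
  half-positive with ⌊ j /2⌋ in half-j
  ... | suc _ = s≤s z≤n
  ... | zero  = contradiction (subst (1 ≤_) j≡0 1≤j) λ ()
    where
    j≡0 : j ≡ 0
    j≡0 = trans (sym (odd∷ᵇ⌊/2⌋ j)) (cong₂ _∷ᵇ_ odd-j half-j)

¬T⇒false : ∀ {b} → (T b → ⊥) → b ≡ false
¬T⇒false {false} _  = refl
¬T⇒false {true}  ¬T = contradiction _ ¬T

≤ᵇ-true : ∀ {m n} → m ≤ n → (m ≤ᵇ n) ≡ true
≤ᵇ-true = Equivalence.to T-≡ ∘ ≤⇒≤ᵇ

≤ᵇ-false : ∀ {m n} → n < m → (m ≤ᵇ n) ≡ false
≤ᵇ-false {m} {n} n<m = ¬T⇒false (<⇒≱ n<m ∘ ≤ᵇ⇒≤ m n)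

<ᵇ-true : ∀ {m n} → m < n → (m <ᵇ n) ≡ true
<ᵇ-true = Equivalence.to T-≡ ∘ <⇒<ᵇ

<ᵇ-false : ∀ {m n} → n ≤ m → (m <ᵇ n) ≡ false
<ᵇ-false {m} {n} n≤m = ¬T⇒false (≤⇒≯ n≤m ∘ <ᵇ⇒< m n)

<ᵇ-as-≤ᵇ : ∀ a x → (a <ᵇ x) ≡ not (x ≤ᵇ a)
<ᵇ-as-≤ᵇ a x with x ≤? a
... | yes x≤a = trans (<ᵇ-false x≤a) (cong not (sym (≤ᵇ-true x≤a)))
... | no  x≰a = trans (<ᵇ-true (≰⇒> x≰a)) (cong not (sym (≤ᵇ-false (≰⇒> x≰a))))

≡ᵇ-true : ∀ m → (m ≡ᵇ m) ≡ true
≡ᵇ-true m = Equivalence.to T-≡ (≡⇒≡ᵇ m m refl)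

≡ᵇ-false : ∀ {m n} → m ≢ n → (m ≡ᵇ n) ≡ false
≡ᵇ-false {m} {n} m≢n = ¬T⇒false (m≢n ∘ ≡ᵇ⇒≡ m n)

∧-not : ∀ d e → d ∧ not e ≡ d xor (d ∧ e)
∧-not false _     = refl
∧-not true  false = refl
∧-not true  true  = refl

xorSum : ℕ → (ℕ → Bool) → Bool
xorSum zero    f = false
xorSum (suc K) f = xorSum K f xor f (suc K)

xorSum-cong : ∀ K {f g} → (∀ x → 1 ≤ x → x ≤ K → f x ≡ g x) → xorSum K f ≡ xorSum K g
xorSum-cong zero    _   = refl
xorSum-cong (suc K) f≗g =
  cong₂ _xor_ (xorSum-cong K λ x 1≤x x≤K → f≗g x 1≤x (m≤n⇒m≤1+n x≤K)) (f≗g (suc K) (s≤s z≤n) ≤-refl)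

xorSum-false : ∀ K {f} → (∀ x → 1 ≤ x → x ≤ K → f x ≡ false) → xorSum K f ≡ false
xorSum-false zero    _   = refl
xorSum-false (suc K) f≗0 =
  cong₂ _xor_ (xorSum-false K λ x 1≤x x≤K → f≗0 x 1≤x (m≤n⇒m≤1+n x≤K)) (f≗0 (suc K) (s≤s z≤n) ≤-refl)

xorSum-⊕ : ∀ K f g → xorSum K (f ⊕ g) ≡ xorSum K f xor xorSum K g
xorSum-⊕ zero    f g = refl
xorSum-⊕ (suc K) f g = trans (cong (_xor (f (suc K) xor g (suc K))) (xorSum-⊕ K f g))
                             (interchange (xorSum K f) (xorSum K g) (f (suc K)) (g (suc K)))
  where
  open xor-∧-Solver
  interchange : ∀ a b c d → (a xor b) xor (c xor d) ≡ (a xor c) xor (b xor d)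
  interchange = solve 4 (λ a b c d → (a :+ b) :+ (c :+ d) := (a :+ c) :+ (b :+ d)) refl

xorSum-multiples : ∀ b K → xorSum K (2^ b ∣ᵇ_) ≡ testBit K b
xorSum-multiples b zero    = sym (testBit-0 b)
xorSum-multiples b (suc K) = trans (cong (_xor 2^ b ∣ᵇ suc K) (xorSum-multiples b K)) (sym (testBit-suc K b))

xorSum-≤ᵇ : ∀ (f : ℕ → Bool) {c K} → c ≤ K → xorSum K (λ x → f x ∧ (x ≤ᵇ c)) ≡ xorSum c f
xorSum-≤ᵇ f {c} {K} c≤K = trans (cong (λ K → xorSum K f≤c) (sym (m+[n∸m]≡n c≤K))) (beyond (K ∸ c))
  where
  f≤c : ℕ → Bool
  f≤c x = f x ∧ (x ≤ᵇ c)
  beyond : ∀ d → xorSum (c + d) f≤c ≡ xorSum c f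
  beyond zero    = trans (cong (λ K → xorSum K f≤c) (+-identityʳ c))
                         (xorSum-cong c λ x _ x≤c → trans (cong (f x ∧_) (≤ᵇ-true x≤c)) (∧-identityʳ (f x)))
  beyond (suc d) = begin
    xorSum (c + suc d) f≤c                     ≡⟨ cong (λ K → xorSum K f≤c) (+-suc c d) ⟩
    xorSum (c + d) f≤c xor f≤c (suc (c + d))   ≡⟨ cong₂ _xor_ (beyond d)
                                                              (cong (f (suc (c + d)) ∧_) (≤ᵇ-false (s≤s (m≤m+n c d)))) ⟩
    xorSum c f xor (f (suc (c + d)) ∧ false)   ≡⟨ cong (xorSum c f xor_) (∧-zeroʳ (f (suc (c + d)))) ⟩
    xorSum c f xor false                       ≡⟨ xor-identityʳ (xorSum c f) ⟩
    xorSum c f                                 ∎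
    where open ≡-Reasoning

xorSum-≡ᵇ : ∀ (f : ℕ → Bool) {j} K → 1 ≤ j → j ≤ K → xorSum K (λ x → f x ∧ (x ≡ᵇ j)) ≡ f j
xorSum-≡ᵇ f {suc _} zero _ ()
xorSum-≡ᵇ f {j} (suc K) 1≤j j≤1+K with j ≤? K
... | yes j≤K = trans (cong₂ _xor_ (xorSum-≡ᵇ f K 1≤j j≤K) (not-j (suc K) (<⇒≢ (s≤s j≤K) ∘ sym)))
                      (xor-identityʳ (f j))
  where
  not-j : ∀ x → x ≢ j → f x ∧ (x ≡ᵇ j) ≡ false
  not-j x x≢j = trans (cong (f x ∧_) (≡ᵇ-false x≢j)) (∧-zeroʳ (f x))
... | no j≰K = begin
  xorSum K fj xor fj (suc K)   ≡⟨ cong₂ _xor_ (xorSum-false K below-j) (cong fj (sym j≡1+K)) ⟩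
  false xor fj j               ≡⟨ cong (f j ∧_) (≡ᵇ-true j) ⟩
  f j ∧ true                   ≡⟨ ∧-identityʳ (f j) ⟩
  f j                          ∎
  where
  open ≡-Reasoning
  fj : ℕ → Bool
  fj x = f x ∧ (x ≡ᵇ j)
  j≡1+K : j ≡ suc K
  j≡1+K = ≤-antisym j≤1+K (≰⇒> j≰K)
  below-j : ∀ x → 1 ≤ x → x ≤ K → fj x ≡ false
  below-j x _ x≤K = trans (cong (f x ∧_) (≡ᵇ-false (<⇒≢ (≤-<-trans x≤K (≰⇒> j≰K))))) (∧-zeroʳ (f x))

-- Rigidity of sums under bitwise translation

xor-cancelˡ : ∀ a {x y} → a xor x ≡ a xor y → x ≡ y
xor-cancelˡ false eq = eq
xor-cancelˡ true  eq = not-injective eq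

xor-cancelʳ : ∀ a {x y} → x xor a ≡ y xor a → x ≡ y
xor-cancelʳ a {x} {y} eq = xor-cancelˡ a (trans (xor-comm a x) (trans eq (xor-comm y a)))

lsb-rigid : ∀ {a a' x x' y y' c d} → x xor y xor c ≡ a xor d → x' xor y' xor c ≡ a' xor d →
            a xor x ≡ a' xor x' → a xor y ≡ a' xor y' → a ≡ a'
lsb-rigid {a} {a'} {x} {x'} {y} {y'} {c} {d} sum sum' ax ay = xor-cancelʳ d (begin
  a xor d                               ≡⟨ sym sum ⟩
  x xor y xor c                         ≡⟨ sym (xor-assoc x y c) ⟩
  (x xor y) xor c                       ≡⟨ cong (_xor c) (sym (pair a x y)) ⟩
  ((a xor x) xor (a xor y)) xor c       ≡⟨ cong₂ (λ u v → (u xor v) xor c) ax ay ⟩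
  ((a' xor x') xor (a' xor y')) xor c   ≡⟨ cong (_xor c) (pair a' x' y') ⟩
  (x' xor y') xor c                     ≡⟨ xor-assoc x' y' c ⟩
  x' xor y' xor c                       ≡⟨ sum' ⟩
  a' xor d                              ∎)
  where
  open ≡-Reasoning
  open xor-∧-Solver
  pair : ∀ a x y → (a xor x) xor (a xor y) ≡ x xor y
  pair = solve 3 (λ a x y → (a :+ x) :+ (a :+ y) := x :+ y) refl

-- Going up from the lowest bit, bit b of a is determined by the bits b of a ⊕ x and a ⊕ y
-- and by the incoming carries, which only depend on the lower bits.
xor-sum-rigid : ∀ M {a a' x x' y y' c d} →
  AgreeBelow M (testBit (x + y + fromBool c)) (testBit (a + fromBool d)) →
  AgreeBelow M (testBit (x' + y' + fromBool c)) (testBit (a' + fromBool d)) →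
  AgreeBelow M (testBit a ⊕ testBit x) (testBit a' ⊕ testBit x') →
  AgreeBelow M (testBit a ⊕ testBit y) (testBit a' ⊕ testBit y') →
  AgreeBelow M (testBit a) (testBit a')
xor-sum-rigid zero _ _ _ _ _ ()
xor-sum-rigid (suc M) {a} {a'} {x} {x'} {y} {y'} {c} {d} sum sum' ax ay =
  agree-cons odd-a≡ (xor-sum-rigid M (halves {x} {y} {a} sum) halves' (agree-tail ax) (agree-tail ay))
  where
  lsb : ∀ {x y a} → AgreeBelow (suc M) (testBit (x + y + fromBool c)) (testBit (a + fromBool d)) →
        odd x xor odd y xor c ≡ odd a xor d
  lsb {x} {y} {a} s = trans (sym (odd-+ x y c)) (trans (agree-head s) (odd-+carry a d))
  halves : ∀ {x y a} → AgreeBelow (suc M) (testBit (x + y + fromBool c)) (testBit (a + fromBool d)) →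
           AgreeBelow M (testBit (halfSum x y c)) (testBit (⌊ a /2⌋ + fromBool (odd a ∧ d)))
  halves {x} {y} {a} s =
    subst₂ (λ u v → AgreeBelow M (testBit u) (testBit v)) (⌊+/2⌋ x y c) (⌊+carry/2⌋ a d) (agree-tail s)
  odd-a≡ : odd a ≡ odd a'
  odd-a≡ = lsb-rigid {c = c} {d} (lsb {x} {y} {a} sum) (lsb {x'} {y'} {a'} sum') (agree-head ax) (agree-head ay)
  odd-x≡ : odd x ≡ odd x'
  odd-x≡ = xor-cancelˡ (odd a') (trans (cong (_xor odd x) (sym odd-a≡)) (agree-head ax))
  odd-y≡ : odd y ≡ odd y'
  odd-y≡ = xor-cancelˡ (odd a') (trans (cong (_xor odd y) (sym odd-a≡)) (agree-head ay))
  halves' : AgreeBelow M (testBit (⌊ x' /2⌋ + ⌊ y' /2⌋ + fromBool (carry (odd x) (odd y) c)))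
                         (testBit (⌊ a' /2⌋ + fromBool (odd a ∧ d)))
  halves' = subst₂ (λ c₁ d₁ → AgreeBelow M (testBit (⌊ x' /2⌋ + ⌊ y' /2⌋ + fromBool c₁))
                                           (testBit (⌊ a' /2⌋ + fromBool d₁)))
                   (cong₂ (λ u v → carry u v c) (sym odd-x≡) (sym odd-y≡))
                   (cong (_∧ d) (sym odd-a≡))
                   (halves {x'} {y'} {a'} sum')

+-cancelˡ-testBit : ∀ M {p p' L L' c} → AgreeBelow M (testBit p) (testBit p') →
  AgreeBelow M (testBit (p + L + fromBool c)) (testBit (p' + L' + fromBool c)) →
  AgreeBelow M (testBit L) (testBit L')
+-cancelˡ-testBit zero _ _ _ ()
+-cancelˡ-testBit (suc M) {p} {p'} {L} {L'} {c} p≈p' sum≈sum' =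
  agree-cons odd-L≡ (+-cancelˡ-testBit M (agree-tail p≈p') halves)
  where
  odd-L≡ : odd L ≡ odd L'
  odd-L≡ = xor-cancelʳ c (xor-cancelˡ (odd p) (begin
    odd p xor odd L xor c        ≡⟨ sym (odd-+ p L c) ⟩
    odd (p + L + fromBool c)     ≡⟨ agree-head sum≈sum' ⟩
    odd (p' + L' + fromBool c)   ≡⟨ odd-+ p' L' c ⟩
    odd p' xor odd L' xor c      ≡⟨ cong (_xor (odd L' xor c)) (sym (agree-head p≈p')) ⟩
    odd p xor odd L' xor c       ∎))
    where open ≡-Reasoning
  halves : AgreeBelow M (testBit (halfSum p L c))
                        (testBit (⌊ p' /2⌋ + ⌊ L' /2⌋ + fromBool (carry (odd p) (odd L) c)))
  halves = subst₂ (λ u v → AgreeBelow M (testBit u) (testBit v))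
                  (⌊+/2⌋ p L c)
                  (trans (⌊+/2⌋ p' L' c)
                         (cong₂ (λ u v → ⌊ p' /2⌋ + ⌊ L' /2⌋ + fromBool (carry u v c))
                                (sym (agree-head p≈p')) (sym odd-L≡)))
                  (agree-tail sum≈sum')

-- x = p + L and y = 2^M - L + δ add up to p + δ modulo 2^M. Since p is even, the lowest bit
-- gives δ = δ'; then xor-sum-rigid gives p ≡ p' modulo 2^M, and cancelling p gives L = L'.
offset-unique : ∀ M {p p' L L' δ δ'} → 1 ≤ M → odd p ≡ false → odd p' ≡ false → L < 2 ^ M → L' < 2 ^ M →
  AgreeBelow M (testBit p ⊕ testBit (p + L)) (testBit p' ⊕ testBit (p' + L')) →
  AgreeBelow M (testBit p ⊕ testBit (2 ^ M ∸ L + fromBool δ)) (testBit p' ⊕ testBit (2 ^ M ∸ L' + fromBool δ')) →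
  L ≡ L'
offset-unique M {p} {p'} {L} {L'} {δ} {δ'} 1≤M even even' L<2^M L'<2^M ax ay =
  testBit-injective M L<2^M L'<2^M (+-cancelˡ-testBit M p≈p' (subst₂ (λ u v → AgreeBelow M (testBit u) (testBit v))
                                                                      (sym (+-identityʳ (p + L)))
                                                                      (sym (+-identityʳ (p' + L')))
                                                                      x≈x'))
  where
  sum≈ : ∀ {p L} δ → L < 2 ^ M →
         AgreeBelow M (testBit ((p + L) + (2 ^ M ∸ L + fromBool δ) + fromBool false)) (testBit (p + fromBool δ))
  sum≈ {p} {L} δ L<2^M b b<M = trans (cong (λ z → testBit z b) total) (testBit-2^+ M (p + fromBool δ) b<M)
    where
    regroup : ∀ p L w d → (p + L) + (w + d) + 0 ≡ (L + w) + (p + d)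
    regroup = solve-∀
    total : (p + L) + (2 ^ M ∸ L + fromBool δ) + 0 ≡ 2 ^ M + (p + fromBool δ)
    total = trans (regroup p L (2 ^ M ∸ L) (fromBool δ)) (cong (_+ (p + fromBool δ)) (m+[n∸m]≡n (<⇒≤ L<2^M)))
  carry-in : ∀ {p L} δ → odd p ≡ false → L < 2 ^ M → δ ≡ odd (p + L) xor odd (2 ^ M ∸ L + fromBool δ) xor false
  carry-in {p} {L} δ even-p L<2^M = begin
    δ                                                          ≡⟨ cong (_xor δ) (sym even-p) ⟩
    odd p xor δ                                                ≡⟨ sym (odd-+carry p δ) ⟩
    odd (p + fromBool δ)                                       ≡⟨ sym (sum≈ {p} δ L<2^M 0 1≤M) ⟩
    odd ((p + L) + (2 ^ M ∸ L + fromBool δ) + fromBool false)  ≡⟨ odd-+ (p + L) (2 ^ M ∸ L + fromBool δ) false ⟩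
    odd (p + L) xor odd (2 ^ M ∸ L + fromBool δ) xor false     ∎
    where open ≡-Reasoning
  unpad : ∀ {u v} → odd p xor u ≡ odd p' xor v → u ≡ v
  unpad {u} {v} = subst₂ (λ a a' → a xor u ≡ a' xor v) even even'
  δ≡δ' : δ ≡ δ'
  δ≡δ' = trans (carry-in {p} δ even L<2^M)
        (trans (cong₂ (λ u v → u xor v xor false) (unpad (ax 0 1≤M)) (unpad (ay 0 1≤M)))
               (sym (carry-in {p'} δ' even' L'<2^M)))
  p≈p' : AgreeBelow M (testBit p) (testBit p')
  p≈p' = xor-sum-rigid M (sum≈ {p} δ L<2^M) (sum≈ {p'} δ L'<2^M) ax
           (subst (λ d → AgreeBelow M (testBit p ⊕ testBit (2 ^ M ∸ L + fromBool δ))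
                                      (testBit p' ⊕ testBit (2 ^ M ∸ L' + fromBool d)))
                  (sym δ≡δ') ay)
  x≈x' : AgreeBelow M (testBit (p + L)) (testBit (p' + L'))
  x≈x' b b<M = xor-cancelˡ (testBit p b) (trans (ax b b<M) (cong (_xor testBit (p' + L') b) (sym (p≈p' b b<M))))

memℕ-Δ : ∀ {k} (u v : Subset k) x → memℕ (u Δ v) x ≡ memℕ u x xor memℕ v x
memℕ-Δ []      []      x             = refl
memℕ-Δ (_ ∷ _) (_ ∷ _) zero          = refl
memℕ-Δ (_ ∷ _) (_ ∷ _) (suc zero)    = refl
memℕ-Δ (_ ∷ u) (_ ∷ v) (suc (suc x)) = memℕ-Δ u v (suc x)

memℕ-fromPred : ∀ k (p : ℕ → Bool) {x} → 1 ≤ x → x ≤ k → memℕ (fromPred {k} p) x ≡ p x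
memℕ-fromPred (suc k) p {suc zero}    _ _         = refl
memℕ-fromPred (suc k) p {suc (suc x)} _ (s≤s x≤k) = memℕ-fromPred k (p ∘ suc) (s≤s z≤n) x≤k

memℕ-empty : ∀ k x → memℕ (replicate k false) x ≡ false
memℕ-empty zero    _             = refl
memℕ-empty (suc k) zero          = refl
memℕ-empty (suc k) (suc zero)    = refl
memℕ-empty (suc k) (suc (suc x)) = memℕ-empty k (suc x)

memℕ-ext : ∀ {k} (u v : Subset k) → (∀ x → 1 ≤ x → x ≤ k → memℕ u x ≡ memℕ v x) → u ≡ v
memℕ-ext []      []      _   = refl
memℕ-ext (a ∷ u) (b ∷ v) u≗v = cong₂ _∷_ (u≗v 1 (s≤s z≤n) (s≤s z≤n))
  (memℕ-ext u v λ { (suc x) _ x≤k → u≗v (suc (suc x)) (s≤s z≤n) (s≤s x≤k) })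

Δ-assoc : ∀ {k} (u v w : Subset k) → u Δ v Δ w ≡ u Δ (v Δ w)
Δ-assoc = zipWith-assoc xor-assoc

Δ-cancelʳ : ∀ {k} (u v : Subset k) → u Δ v Δ v ≡ u
Δ-cancelʳ []      []      = refl
Δ-cancelʳ (a ∷ u) (b ∷ v) =
  cong₂ _∷_ (trans (xor-assoc a b b) (trans (cong (a xor_) (xor-same b)) (xor-identityʳ a))) (Δ-cancelʳ u v)

Δ-exchange : ∀ {k} (q y y' b : Subset k) → q Δ y Δ b ≡ (q Δ y' Δ b) Δ (y' Δ y)
Δ-exchange []      []      []        []      = refl
Δ-exchange (q ∷ Q) (y ∷ Y) (y' ∷ Y') (b ∷ B) = cong₂ _∷_ (exchange q y y' b) (Δ-exchange Q Y Y' B)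
  where
  open xor-∧-Solver
  exchange : ∀ q y y' b → (q xor y) xor b ≡ ((q xor y') xor b) xor (y' xor y)
  exchange = solve 4 (λ q y y' b → (q :+ y) :+ b := ((q :+ y') :+ b) :+ (y' :+ y)) refl

-- The invariants μ

module Invariants (M : ℕ) where

  m N : ℕ
  m = suc M
  N = 2 ^ M

  n≡N+N : nOf m ≡ N + N
  n≡N+N = cong (N +_) (+-identityʳ N)

  ≤N⇒≤n : ∀ {x} → x ≤ N → x ≤ nOf m
  ≤N⇒≤n {x} x≤N = subst (x ≤_) (sym n≡N+N) (≤-trans x≤N (m≤m+n N N))

  N+≤n : ∀ {x} → x ≤ N → N + x ≤ nOf m
  N+≤n {x} x≤N = subst (N + x ≤_) (sym n≡N+N) (+-monoʳ-≤ N x≤N)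

  N<N+ : ∀ {x} → 1 ≤ x → N < N + x
  N<N+ {x} 1≤x = subst (_< N + x) (+-identityʳ N) (+-monoʳ-< N 1≤x)

  μ : ℕ → Subset (nOf m) → ℕ → Bool
  μ o S b = xorSum N (λ x → 2^ b ∣ᵇ x ∧ memℕ S (o + x))

  μ-Δ : ∀ o S T b → μ o (S Δ T) b ≡ μ o S b xor μ o T b
  μ-Δ o S T b = trans (xorSum-cong N λ x _ _ → trans (cong (d x ∧_) (memℕ-Δ S T (o + x)))
                                                     (∧-distribˡ-xor (d x) (memℕ S (o + x)) (memℕ T (o + x))))
                      (xorSum-⊕ N (λ x → d x ∧ memℕ S (o + x)) (λ x → d x ∧ memℕ T (o + x)))
    where
    d = 2^ b ∣ᵇ_

  μ-vanishes : ∀ o S b → (∀ x → 1 ≤ x → x ≤ N → memℕ S (o + x) ≡ false) → μ o S b ≡ false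
  μ-vanishes o S b S∌ =
    xorSum-false N λ x 1≤x x≤N → trans (cong (2^ b ∣ᵇ x ∧_) (S∌ x 1≤x x≤N)) (∧-zeroʳ (2^ b ∣ᵇ x))

  μ-high-vanishes : ∀ S b → (∀ y → N < y → y ≤ nOf m → memℕ S y ≡ false) → μ N S b ≡ false
  μ-high-vanishes S b S∌ = μ-vanishes N S b λ x 1≤x x≤N → S∌ (N + x) (N<N+ 1≤x) (N+≤n x≤N)

  -- {1,…,N} contains an even number, 2^(M - b), of multiples of 2^b.
  μ-low-complement : ∀ S T {b} → b < M → (∀ x → 1 ≤ x → x ≤ N → memℕ S x ≡ not (memℕ T x)) →
                     μ 0 S b ≡ μ 0 T b
  μ-low-complement S T {b} b<M S≗∁T = begin
    μ 0 S b
      ≡⟨ xorSum-cong N (λ x 1≤x x≤N → trans (cong (d x ∧_) (S≗∁T x 1≤x x≤N)) (∧-not (d x) (memℕ T x))) ⟩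
    xorSum N (d ⊕ (λ x → d x ∧ memℕ T x))
      ≡⟨ xorSum-⊕ N d (λ x → d x ∧ memℕ T x) ⟩
    xorSum N d xor μ 0 T b
      ≡⟨ cong (_xor μ 0 T b) (trans (xorSum-multiples b N) (testBit-2^ M b<M)) ⟩
    μ 0 T b ∎
    where
    open ≡-Reasoning
    d = 2^ b ∣ᵇ_

  memℕ-θ : ∀ X {x} → 1 ≤ x → x ≤ nOf m → memℕ (θ m X) x ≡ (N <ᵇ x) ∧ memℕ X (x ∸ N)
  memℕ-θ X = memℕ-fromPred (nOf m) (λ x → (N <ᵇ x) ∧ memℕ X (x ∸ N))

  θ-Δ : ∀ X Y → θ m (X Δ Y) ≡ θ m X Δ θ m Y
  θ-Δ X Y = memℕ-ext (θ m (X Δ Y)) (θ m X Δ θ m Y) λ x 1≤x x≤n → begin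
    memℕ (θ m (X Δ Y)) x                    ≡⟨ memℕ-θ (X Δ Y) 1≤x x≤n ⟩
    g x ∧ memℕ (X Δ Y) (x ∸ N)              ≡⟨ cong (g x ∧_) (memℕ-Δ X Y (x ∸ N)) ⟩
    g x ∧ (memℕ X (x ∸ N) xor memℕ Y (x ∸ N))
                                            ≡⟨ ∧-distribˡ-xor (g x) (memℕ X (x ∸ N)) (memℕ Y (x ∸ N)) ⟩
    (g x ∧ memℕ X (x ∸ N)) xor (g x ∧ memℕ Y (x ∸ N))
                                            ≡⟨ sym (cong₂ _xor_ (memℕ-θ X 1≤x x≤n) (memℕ-θ Y 1≤x x≤n)) ⟩
    memℕ (θ m X) x xor memℕ (θ m Y) x       ≡⟨ sym (memℕ-Δ (θ m X) (θ m Y) x) ⟩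
    memℕ (θ m X Δ θ m Y) x                  ∎
    where
    open ≡-Reasoning
    g = N <ᵇ_

  θ-cong : ∀ X Y → (∀ y → 1 ≤ y → y ≤ N → memℕ X y ≡ memℕ Y y) → θ m X ≡ θ m Y
  θ-cong X Y X≗Y = memℕ-ext (θ m X) (θ m Y) λ x 1≤x x≤n →
    trans (memℕ-θ X 1≤x x≤n) (trans (shifted x x≤n) (sym (memℕ-θ Y 1≤x x≤n)))
    where
    shifted : ∀ x → x ≤ nOf m → (N <ᵇ x) ∧ memℕ X (x ∸ N) ≡ (N <ᵇ x) ∧ memℕ Y (x ∸ N)
    shifted x x≤n with N <? x
    ... | yes N<x =
      cong ((N <ᵇ x) ∧_) (X≗Y (x ∸ N) (m<n⇒0<n∸m N<x) (m≤n+o⇒m∸n≤o x N (subst (x ≤_) n≡N+N x≤n)))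
    ... | no  N≮x rewrite <ᵇ-false (≮⇒≥ N≮x) = refl

  μ-low-θ : ∀ X b → μ 0 (θ m X) b ≡ false
  μ-low-θ X b = μ-vanishes 0 (θ m X) b λ x 1≤x x≤N →
    trans (memℕ-θ X 1≤x (≤N⇒≤n x≤N)) (cong (_∧ memℕ X (x ∸ N)) (<ᵇ-false x≤N))

  μ-high-θ : ∀ X b → μ N (θ m X) b ≡ μ 0 X b
  μ-high-θ X b = xorSum-cong N λ x 1≤x x≤N → cong (2^ b ∣ᵇ x ∧_) (begin
    memℕ (θ m X) (N + x)
      ≡⟨ memℕ-θ X (≤-trans 1≤x (m≤n+m x N)) (N+≤n x≤N) ⟩
    (N <ᵇ N + x) ∧ memℕ X (N + x ∸ N)
      ≡⟨ cong₂ _∧_ (<ᵇ-true (N<N+ 1≤x)) (cong (memℕ X) (m+n∸m≡n N x)) ⟩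
    memℕ X x ∎)
    where open ≡-Reasoning

  memℕ-br : ∀ k {x} → 1 ≤ x → x ≤ nOf m →
            memℕ (br m k) x ≡ (if k ≤ᵇ N then (1 ≤ᵇ x) ∧ (x ≤ᵇ k) else ((k ∸ N) <ᵇ x) ∧ (x ≤ᵇ N))
  memℕ-br k =
    memℕ-fromPred (nOf m) (λ x → if k ≤ᵇ N then (1 ≤ᵇ x) ∧ (x ≤ᵇ k) else ((k ∸ N) <ᵇ x) ∧ (x ≤ᵇ N))

  memℕ-br-short : ∀ {k x} → k ≤ N → 1 ≤ x → x ≤ N → memℕ (br m k) x ≡ (x ≤ᵇ k)
  memℕ-br-short {k} {x} k≤N 1≤x x≤N
    rewrite memℕ-br k 1≤x (≤N⇒≤n x≤N) | ≤ᵇ-true k≤N | ≤ᵇ-true 1≤x = refl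

  memℕ-br-long : ∀ {k x} → N < k → k ≤ N + N → 1 ≤ x → x ≤ N →
                 memℕ (br m k) x ≡ not (memℕ (br m (k ∸ N)) x)
  memℕ-br-long {k} {x} N<k k≤N+N 1≤x x≤N
    rewrite memℕ-br k 1≤x (≤N⇒≤n x≤N) | ≤ᵇ-false N<k | ≤ᵇ-true x≤N
          | memℕ-br-short (m≤n+o⇒m∸n≤o k N k≤N+N) 1≤x x≤N
    = trans (∧-identityʳ ((k ∸ N) <ᵇ x)) (<ᵇ-as-≤ᵇ (k ∸ N) x)

  memℕ-br-high : ∀ k {y} → N < y → y ≤ nOf m → memℕ (br m k) y ≡ false
  memℕ-br-high k {y} N<y y≤n rewrite memℕ-br k (≤-trans (s≤s z≤n) N<y) y≤n with k ≤? N
  ... | yes k≤N rewrite ≤ᵇ-true k≤N | ≤ᵇ-false (≤-<-trans k≤N N<y) = ∧-zeroʳ (1 ≤ᵇ y)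
  ... | no  k≰N rewrite ≤ᵇ-false (≰⇒> k≰N) | ≤ᵇ-false N<y = ∧-zeroʳ ((k ∸ N) <ᵇ y)

  μ-low-br-short : ∀ {k} b → k ≤ N → μ 0 (br m k) b ≡ testBit k b
  μ-low-br-short {k} b k≤N = begin
    μ 0 (br m k) b
      ≡⟨ xorSum-cong N (λ x 1≤x x≤N → cong (d x ∧_) (memℕ-br-short k≤N 1≤x x≤N)) ⟩
    xorSum N (λ x → d x ∧ (x ≤ᵇ k))
      ≡⟨ xorSum-≤ᵇ d k≤N ⟩
    xorSum k d
      ≡⟨ xorSum-multiples b k ⟩
    testBit k b ∎
    where
    open ≡-Reasoning
    d = 2^ b ∣ᵇ_

  μ-low-br : ∀ k {b} → b < M → k < N + N → μ 0 (br m k) b ≡ testBit k b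
  μ-low-br k {b} b<M k<N+N with k ≤? N
  ... | yes k≤N = μ-low-br-short b k≤N
  ... | no  k≰N = begin
    μ 0 (br m k) b            ≡⟨ μ-low-complement (br m k) (br m (k ∸ N)) b<M
                                                    (λ _ → memℕ-br-long N<k (<⇒≤ k<N+N)) ⟩
    μ 0 (br m (k ∸ N)) b      ≡⟨ μ-low-br-short b (m≤n+o⇒m∸n≤o k N (<⇒≤ k<N+N)) ⟩
    testBit (k ∸ N) b         ≡⟨ sym (testBit-2^+ M (k ∸ N) b<M) ⟩
    testBit (N + (k ∸ N)) b   ≡⟨ cong (λ z → testBit z b) (m+[n∸m]≡n (<⇒≤ N<k)) ⟩
    testBit k b               ∎
    where
    open ≡-Reasoning
    N<k : N < k
    N<k = ≰⇒> k≰N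

  μ-high-br : ∀ k b → μ N (br m k) b ≡ false
  μ-high-br k b = μ-high-vanishes (br m k) b λ _ → memℕ-br-high k

  memℕ-cbar : ∀ X {x} → 1 ≤ x → x ≤ N → memℕ (cbar m X) x ≡ not (memℕ X x)
  memℕ-cbar X {x} 1≤x x≤N
    rewrite memℕ-fromPred (nOf m) (λ x → (1 ≤ᵇ x) ∧ (x ≤ᵇ N) ∧ not (memℕ X x)) 1≤x (≤N⇒≤n x≤N)
          | ≤ᵇ-true 1≤x | ≤ᵇ-true x≤N = refl

  μ-low-cbar : ∀ X {b} → b < M → μ 0 (cbar m X) b ≡ μ 0 X b
  μ-low-cbar X b<M = μ-low-complement (cbar m X) X b<M λ _ → memℕ-cbar X

  μ-high-cbar : ∀ X b → μ N (cbar m X) b ≡ false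
  μ-high-cbar X b = μ-high-vanishes (cbar m X) b λ y N<y y≤n →
    trans (memℕ-fromPred (nOf m) (λ x → (1 ≤ᵇ x) ∧ (x ≤ᵇ N) ∧ not (memℕ X x)) (≤-trans (s≤s z≤n) N<y) y≤n)
          (trans (cong (λ t → (1 ≤ᵇ y) ∧ t ∧ not (memℕ X y)) (≤ᵇ-false N<y)) (∧-zeroʳ (1 ≤ᵇ y)))

  gen-bounds : ∀ {i j} → 1 ≤ i → i ≤ M → j ≤ 2 ^ (i ∸ 1) ∸ 1 → j < 2 ^ (i ∸ 1) × 2 ^ (i ∸ 1) + j ≤ N
  gen-bounds {suc i} {j} _ i≤M j≤q-1 = j<q , (begin
    q + j         ≤⟨ +-monoʳ-≤ q (<⇒≤ j<q) ⟩
    q + q         ≡⟨ cong (q +_) (sym (+-identityʳ q)) ⟩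
    2 ^ suc i     ≤⟨ ^-monoʳ-≤ 2 i≤M ⟩
    N             ∎)
    where
    open ≤-Reasoning
    q = 2 ^ i
    j<q : j < q
    j<q with 2 ^ i | m^n>0 2 i
    ... | suc _ | _ = s≤s j≤q-1

  memℕ-gen : ∀ i j {x} → 1 ≤ x → x ≤ nOf m → memℕ (gen m i j) x ≡ (x ≡ᵇ j) xor (x ≡ᵇ 2 ^ (i ∸ 1) + j)
  memℕ-gen i j = memℕ-fromPred (nOf m) (λ x → (x ≡ᵇ j) xor (x ≡ᵇ 2 ^ (i ∸ 1) + j))

  μ-low-gen : ∀ {i j} b → 1 ≤ i → i ≤ M → 1 ≤ j → j ≤ 2 ^ (i ∸ 1) ∸ 1 → μ 0 (gen m i j) b ≡ false
  μ-low-gen {i} {j} b 1≤i i≤M 1≤j j≤q-1 = begin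
    μ 0 (gen m i j) b
      ≡⟨ xorSum-cong N (λ x 1≤x x≤N → trans (cong (d x ∧_) (memℕ-gen i j 1≤x (≤N⇒≤n x≤N)))
                                           (∧-distribˡ-xor (d x) (x ≡ᵇ j) (x ≡ᵇ q + j))) ⟩
    xorSum N ((λ x → d x ∧ (x ≡ᵇ j)) ⊕ (λ x → d x ∧ (x ≡ᵇ q + j)))
      ≡⟨ xorSum-⊕ N (λ x → d x ∧ (x ≡ᵇ j)) (λ x → d x ∧ (x ≡ᵇ q + j)) ⟩
    xorSum N (λ x → d x ∧ (x ≡ᵇ j)) xor xorSum N (λ x → d x ∧ (x ≡ᵇ q + j))
      ≡⟨ cong₂ _xor_ (xorSum-≡ᵇ d N 1≤j (≤-trans (m≤n+m j q) q+j≤N))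
                     (xorSum-≡ᵇ d N (≤-trans 1≤j (m≤n+m j q)) q+j≤N) ⟩
    d j xor d (q + j)
      ≡⟨ cong (d j xor_) (2^∣ᵇ-2^+ b (i ∸ 1) 1≤j j<q) ⟩
    d j xor d j
      ≡⟨ xor-same (d j) ⟩
    false ∎
    where
    open ≡-Reasoning
    q = 2 ^ (i ∸ 1)
    d = 2^ b ∣ᵇ_
    j<q = proj₁ (gen-bounds 1≤i i≤M j≤q-1)
    q+j≤N = proj₂ (gen-bounds 1≤i i≤M j≤q-1)

  μ-high-gen : ∀ {i j} b → 1 ≤ i → i ≤ M → j ≤ 2 ^ (i ∸ 1) ∸ 1 → μ N (gen m i j) b ≡ false
  μ-high-gen {i} {j} b 1≤i i≤M j≤q-1 = μ-high-vanishes (gen m i j) b λ y N<y y≤n →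
    trans (memℕ-gen i j (≤-trans (s≤s z≤n) N<y) y≤n)
          (cong₂ _xor_ (≡ᵇ-false (>⇒≢ (≤-<-trans (≤-trans (m≤n+m j q) q+j≤N) N<y)))
                       (≡ᵇ-false (>⇒≢ (≤-<-trans q+j≤N N<y))))
    where
    q = 2 ^ (i ∸ 1)
    q+j≤N = proj₂ (gen-bounds 1≤i i≤M j≤q-1)

  μ-H : ∀ o b {A} →
        (∀ {i j} → 2 ≤ i → i ≤ M → 1 ≤ j → j ≤ 2 ^ (i ∸ 1) ∸ 1 → μ o (gen m i j) b ≡ false) →
        InH m A → μ o A b ≡ false
  μ-H o b μ-gen h-empty = μ-vanishes o (replicate (nOf m) false) b λ x _ _ → memℕ-empty (nOf m) (o + x)
  μ-H o b μ-gen (h-step {A} i j 2≤i i≤M 1≤j j≤q-1 A∈H) =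
    trans (μ-Δ o (gen m i j) A b) (cong₂ _xor_ (μ-gen 2≤i i≤M 1≤j j≤q-1) (μ-H o b μ-gen A∈H))

  μ-low-H : ∀ {A} b → InH m A → μ 0 A b ≡ false
  μ-low-H b = μ-H 0 b λ 2≤i i≤M 1≤j j≤q-1 → μ-low-gen b (≤-trans (s≤s z≤n) 2≤i) i≤M 1≤j j≤q-1

  μ-high-H : ∀ {A} b → InH m A → μ N A b ≡ false
  μ-high-H b = μ-H N b λ 2≤i i≤M _ j≤q-1 → μ-high-gen b (≤-trans (s≤s z≤n) 2≤i) i≤M j≤q-1

  vertex : (A P X Q Y B : Subset (nOf m)) → Subset (nOf m)
  vertex A P X Q Y B = A Δ P Δ X Δ θ m (Q Δ Y Δ B)

  μ-low-vertex : ∀ {A} P X Q Y B b → InH m A → μ 0 (vertex A P X Q Y B) b ≡ μ 0 P b xor μ 0 X b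
  μ-low-vertex {A} P X Q Y B b A∈H = begin
    μ 0 (vertex A P X Q Y B) b                      ≡⟨ μ-Δ 0 (A Δ P Δ X) (θ m (Q Δ Y Δ B)) b ⟩
    μ 0 (A Δ P Δ X) b xor μ 0 (θ m (Q Δ Y Δ B)) b   ≡⟨ cong₂ _xor_ (μ-Δ 0 (A Δ P) X b) (μ-low-θ (Q Δ Y Δ B) b) ⟩
    (μ 0 (A Δ P) b xor μ 0 X b) xor false           ≡⟨ xor-identityʳ (μ 0 (A Δ P) b xor μ 0 X b) ⟩
    μ 0 (A Δ P) b xor μ 0 X b                       ≡⟨ cong (_xor μ 0 X b) (μ-Δ 0 A P b) ⟩
    (μ 0 A b xor μ 0 P b) xor μ 0 X b               ≡⟨ cong (λ a → (a xor μ 0 P b) xor μ 0 X b) (μ-low-H b A∈H) ⟩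
    μ 0 P b xor μ 0 X b                             ∎
    where open ≡-Reasoning

  μ-high-vertex : ∀ {A B} P X Q Y b → InH m A → InH m B → μ N P b ≡ false → μ N X b ≡ false →
                  μ N (vertex A P X Q Y B) b ≡ μ 0 Q b xor μ 0 Y b
  μ-high-vertex {A} {B} P X Q Y b A∈H B∈H P-low X-low = begin
    μ N (vertex A P X Q Y B) b                      ≡⟨ μ-Δ N (A Δ P Δ X) (θ m (Q Δ Y Δ B)) b ⟩
    μ N (A Δ P Δ X) b xor μ N (θ m (Q Δ Y Δ B)) b   ≡⟨ cong₂ _xor_ lower-half (μ-high-θ (Q Δ Y Δ B) b) ⟩
    μ 0 (Q Δ Y Δ B) b                               ≡⟨ μ-Δ 0 (Q Δ Y) B b ⟩
    μ 0 (Q Δ Y) b xor μ 0 B b                       ≡⟨ cong₂ _xor_ (μ-Δ 0 Q Y b) (μ-low-H b B∈H) ⟩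
    (μ 0 Q b xor μ 0 Y b) xor false                 ≡⟨ xor-identityʳ (μ 0 Q b xor μ 0 Y b) ⟩
    μ 0 Q b xor μ 0 Y b                             ∎
    where
    open ≡-Reasoning
    lower-half : μ N (A Δ P Δ X) b ≡ false
    lower-half rewrite μ-Δ N (A Δ P) X b | μ-Δ N A P b | μ-high-H b A∈H | P-low | X-low = refl

  vertex-flip : ∀ A P X Q Y Y' B → vertex A P X Q Y B ≡ vertex A P X Q Y' B Δ θ m (Y' Δ Y)
  vertex-flip A P X Q Y Y' B = begin
    A Δ P Δ X Δ θ m (Q Δ Y Δ B)                     ≡⟨ cong (λ Z → A Δ P Δ X Δ θ m Z) (Δ-exchange Q Y Y' B) ⟩
    A Δ P Δ X Δ θ m ((Q Δ Y' Δ B) Δ (Y' Δ Y))       ≡⟨ cong (A Δ P Δ X Δ_) (θ-Δ (Q Δ Y' Δ B) (Y' Δ Y)) ⟩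
    A Δ P Δ X Δ (θ m (Q Δ Y' Δ B) Δ θ m (Y' Δ Y))   ≡⟨ Δ-assoc (A Δ P Δ X) (θ m (Q Δ Y' Δ B)) (θ m (Y' Δ Y)) ⟨
    A Δ P Δ X Δ θ m (Q Δ Y' Δ B) Δ θ m (Y' Δ Y)     ∎
    where open ≡-Reasoning

  -- Common to k ↦ ⟨k⟩ and k ↦ complement of ⟨k⟩, the two shapes of edges of M'_i.
  record Bracket (K : ℕ → Subset (nOf m)) : Set where
    field
      μ-low-bracket  : ∀ k {b} → b < M → k < N + N → μ 0 (K k) b ≡ testBit k b
      μ-high-bracket : ∀ k b → μ N (K k) b ≡ false
      θ-bracket-Δ    : ∀ k k' → θ m (K k Δ K k') ≡ θ m (br m k Δ br m k')

  br-bracket : Bracket (br m)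
  br-bracket = record
    { μ-low-bracket  = μ-low-br
    ; μ-high-bracket = μ-high-br
    ; θ-bracket-Δ    = λ _ _ → refl
    }

  cbar-br-bracket : Bracket (cbar m ∘ br m)
  cbar-br-bracket = record
    { μ-low-bracket  = λ k b<M k<N+N → trans (μ-low-cbar (br m k) b<M) (μ-low-br k b<M k<N+N)
    ; μ-high-bracket = λ k → μ-high-cbar (br m k)
    ; θ-bracket-Δ    = λ k k' → θ-cong (cbar m (br m k) Δ cbar m (br m k')) (br m k Δ br m k') λ y 1≤y y≤N → begin
        memℕ (cbar m (br m k) Δ cbar m (br m k')) y              ≡⟨ memℕ-Δ (cbar m (br m k)) (cbar m (br m k')) y ⟩
        memℕ (cbar m (br m k)) y xor memℕ (cbar m (br m k')) y   ≡⟨ cong₂ _xor_ (memℕ-cbar (br m k) 1≤y y≤N)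
                                                                                 (memℕ-cbar (br m k') 1≤y y≤N) ⟩
        not (memℕ (br m k) y) xor not (memℕ (br m k') y)         ≡⟨ xor-annihilates-not (memℕ (br m k) y)
                                                                                         (memℕ (br m k') y) ⟩
        memℕ (br m k) y xor memℕ (br m k') y                     ≡⟨ sym (memℕ-Δ (br m k) (br m k') y) ⟩
        memℕ (br m k Δ br m k') y                                ∎
    }
    where open ≡-Reasoning

-- Edges of M'

[n+2+p]∸1∸[1+p+L]≡n∸L : ∀ n p L → n + suc (suc p) ∸ 1 ∸ (suc p + L) ≡ n ∸ L + 0
[n+2+p]∸1∸[1+p+L]≡n∸L n p L = begin
  n + suc (suc p) ∸ 1 ∸ (suc p + L)   ≡⟨ cong (λ z → z ∸ 1 ∸ (suc p + L)) (+-suc n (suc p)) ⟩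
  n + suc p ∸ (suc p + L)             ≡⟨ cong (_∸ (suc p + L)) (+-comm n (suc p)) ⟩
  suc p + n ∸ (suc p + L)             ≡⟨ [m+n]∸[m+o]≡n∸o (suc p) n L ⟩
  n ∸ L                               ≡⟨ sym (+-identityʳ (n ∸ L)) ⟩
  n ∸ L + 0                           ∎
  where open ≡-Reasoning

[n+2+p]∸[1+p+L]≡n∸L+1 : ∀ n p L → L ≤ n → n + suc (suc p) ∸ 0 ∸ (suc p + L) ≡ n ∸ L + 1
[n+2+p]∸[1+p+L]≡n∸L+1 n p L L≤n = begin
  n + suc (suc p) ∸ (suc p + L)       ≡⟨ cong (_∸ (suc p + L)) (shuffle n p) ⟩
  suc p + (n + 1) ∸ (suc p + L)       ≡⟨ [m+n]∸[m+o]≡n∸o (suc p) (n + 1) L ⟩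
  n + 1 ∸ L                           ≡⟨ +-∸-comm 1 L≤n ⟩
  n ∸ L + 1                           ∎
  where
  open ≡-Reasoning
  shuffle : ∀ n p → n + suc (suc p) ≡ suc p + (n + 1)
  shuffle = solve-∀

1+p+L≤n+2+p∸2⇒L<n : ∀ n p L → suc p + L ≤ n + suc (suc p) ∸ 2 → L < n
1+p+L≤n+2+p∸2⇒L<n n p L le = +-cancelˡ-< p L n (begin-strict
  p + L                   <⟨ le ⟩
  n + suc (suc p) ∸ 2     ≡⟨ cong (_∸ 2) (trans (+-suc n (suc p)) (cong suc (+-suc n p))) ⟩
  n + p                   ≡⟨ +-comm n p ⟩
  p + n                   ∎)
  where open ≤-Reasoning

2[1+t]≡2+2t : ∀ t → 2 * suc t ≡ suc (suc (2 * t))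
2[1+t]≡2+2t = solve-∀

odd-2* : ∀ t → odd (2 * t) ≡ false
odd-2* t = trans (cong (λ u → odd (t + u)) (+-identityʳ t)) (odd-∷ᵇ false t)

module Matching (M' : ℕ) where

  open Invariants (suc M')
  M = suc M'

  -- The invariants of an endpoint of the edge of M'_i with p = 2i - 2 and r = 2i - 1 + L;
  -- δ = 1 - s for the endpoint written with N - r + 2i - s.
  Signature : Subset (nOf m) → ℕ → ℕ → Bool → Set
  Signature u p L δ = AgreeBelow M (μ 0 u) (testBit p ⊕ testBit (p + L))
                    × AgreeBelow M (μ N u) (testBit p ⊕ testBit (N ∸ L + fromBool δ))

  flip : ℕ → Subset (nOf m)
  flip L = θ m (br m (N ∸ L + 0) Δ br m (N ∸ L + 1))

  record MatchedEdge (u v : Subset (nOf m)) : Set where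
    field
      p L         : ℕ
      p-even      : odd p ≡ false
      L<N         : L < N
      u-signature : Signature u p L false
      v-signature : Signature v p L true
      v≡u⊕flip    : v ≡ u Δ flip L

    u≡v⊕flip : u ≡ v Δ flip L
    u≡v⊕flip = sym (trans (cong (_Δ flip L) v≡u⊕flip) (Δ-cancelʳ u (flip L)))

  open MatchedEdge

  same-offset : ∀ {u v u' v' z z' δ δ'} (e : MatchedEdge u v) (e' : MatchedEdge u' v') →
                Signature z (p e) (L e) δ → Signature z' (p e') (L e') δ' → z ≡ z' → L e ≡ L e'
  same-offset e e' (low , high) (low' , high') refl =
    offset-unique M (s≤s z≤n) (p-even e) (p-even e') (L<N e) (L<N e')
      (λ b b<M → trans (sym (low b b<M)) (low' b b<M))
      (λ b b<M → trans (sym (high b b<M)) (high' b b<M))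

  across : ∀ {x y x' y' L L'} → x ≡ y Δ flip L → x' ≡ y' Δ flip L' → y ≡ y' → L ≡ L' → x ≡ x'
  across refl refl refl refl = refl

  shared-vertex : ∀ {u v u' v'} → MatchedEdge u v → MatchedEdge u' v' →
                  (u ≡ u' ⊎ u ≡ v' ⊎ v ≡ u' ⊎ v ≡ v') → (u ≡ u' × v ≡ v') ⊎ (u ≡ v' × v ≡ u')
  shared-vertex e e' (inj₁ u≡u') =
    inj₁ (u≡u' , across (v≡u⊕flip e) (v≡u⊕flip e') u≡u' (same-offset e e' (u-signature e) (u-signature e') u≡u'))
  shared-vertex e e' (inj₂ (inj₁ u≡v')) =
    inj₂ (u≡v' , across (v≡u⊕flip e) (u≡v⊕flip e') u≡v' (same-offset e e' (u-signature e) (v-signature e') u≡v'))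
  shared-vertex e e' (inj₂ (inj₂ (inj₁ v≡u'))) =
    inj₂ (across (u≡v⊕flip e) (v≡u⊕flip e') v≡u' (same-offset e e' (v-signature e) (u-signature e') v≡u') , v≡u')
  shared-vertex e e' (inj₂ (inj₂ (inj₂ v≡v'))) =
    inj₁ (across (u≡v⊕flip e) (u≡v⊕flip e') v≡v' (same-offset e e' (v-signature e) (v-signature e') v≡v') , v≡v')

  1<N : 1 < N
  1<N = *-monoʳ-≤ 2 (m^n>0 2 M')

  2t<N : ∀ {t} → suc t ≤ 2 ^ M' → 2 * t < N
  2t<N {t} 1+t≤2^M' = ≤-trans (n≤1+n (suc (2 * t))) (subst (_≤ N) (2[1+t]≡2+2t t) (*-monoʳ-≤ 2 1+t≤2^M'))

  vertex-signature : ∀ {K} → Bracket K → ∀ {A B p L} → InH m A → InH m B → p < N → L < N → ∀ δ →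
                     Signature (vertex A (br m p) (K (p + L)) (br m p) (K (N ∸ L + fromBool δ)) B) p L δ
  vertex-signature {K} bracket {A} {B} {p} {L} A∈H B∈H p<N L<N δ = low , high
    where
    open Bracket bracket
    k = N ∸ L + fromBool δ
    p<N+N : p < N + N
    p<N+N = <-≤-trans p<N (m≤m+n N N)
    k<N+N : k < N + N
    k<N+N = ≤-<-trans (+-mono-≤ (m∸n≤m N L) (fromBool≤1 δ)) (+-monoʳ-< N 1<N)
      where
      fromBool≤1 : ∀ δ → fromBool δ ≤ 1
      fromBool≤1 false = z≤n
      fromBool≤1 true  = s≤s z≤n
    low : AgreeBelow M (μ 0 (vertex A (br m p) (K (p + L)) (br m p) (K k) B)) (testBit p ⊕ testBit (p + L))
    low b b<M = trans (μ-low-vertex (br m p) (K (p + L)) (br m p) (K k) B b A∈H)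
                      (cong₂ _xor_ (μ-low-br p b<M p<N+N) (μ-low-bracket (p + L) b<M (+-mono-< p<N L<N)))
    high : AgreeBelow M (μ N (vertex A (br m p) (K (p + L)) (br m p) (K k) B)) (testBit p ⊕ testBit k)
    high b b<M = trans (μ-high-vertex (br m p) (K (p + L)) (br m p) (K k) b A∈H B∈H
                                      (μ-high-br p b) (μ-high-bracket (p + L) b))
                       (cong₂ _xor_ (μ-low-br p b<M p<N+N) (μ-low-bracket k b<M k<N+N))

  offset-edge : ∀ {K} → Bracket K → ∀ {A B p L} → InH m A → InH m B → odd p ≡ false → p < N → L < N →
                MatchedEdge (vertex A (br m p) (K (p + L)) (br m p) (K (N ∸ L + 0)) B)
                            (vertex A (br m p) (K (p + L)) (br m p) (K (N ∸ L + 1)) B)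
  offset-edge {K} bracket {A} {B} {p} {L} A∈H B∈H p-even p<N L<N = record
    { p           = p
    ; L           = L
    ; p-even      = p-even
    ; L<N         = L<N
    ; u-signature = vertex-signature bracket A∈H B∈H p<N L<N false
    ; v-signature = vertex-signature bracket A∈H B∈H p<N L<N true
    ; v≡u⊕flip    = trans (vertex-flip A P X P (K (N ∸ L + 1)) (K (N ∸ L + 0)) B)
                          (cong (vertex A P X P (K (N ∸ L + 0)) B Δ_) (θ-bracket-Δ (N ∸ L + 0) (N ∸ L + 1)))
    }
    where
    open Bracket bracket
    P = br m p
    X = K (p + L)

  form-edge : ∀ {K} → Bracket K → ∀ {A B p q r} → q ≡ suc (suc p) →
              InH m A → InH m B → odd p ≡ false → p < N → q ∸ 1 ≤ r → r ≤ N + q ∸ 2 →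
              MatchedEdge (vertex A (br m (q ∸ 2)) (K (r ∸ 1)) (br m (q ∸ 2)) (K (N + q ∸ 1 ∸ r)) B)
                          (vertex A (br m (q ∸ 2)) (K (r ∸ 1)) (br m (q ∸ 2)) (K (N + q ∸ 0 ∸ r)) B)
  form-edge {K} bracket {A} {B} {p} refl A∈H B∈H p-even p<N lo hi with m≤n⇒∃[o]m+o≡n lo
  ... | L , refl = subst₂ MatchedEdge (cong endpoint (sym ([n+2+p]∸1∸[1+p+L]≡n∸L N p L)))
                                      (cong endpoint (sym ([n+2+p]∸[1+p+L]≡n∸L+1 N p L (<⇒≤ offset<N))))
                                      (offset-edge bracket A∈H B∈H p-even p<N offset<N)
    where
    endpoint : ℕ → Subset (nOf m)
    endpoint k = vertex A (br m p) (K (p + L)) (br m p) (K k) B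
    offset<N : L < N
    offset<N = 1+p+L≤n+2+p∸2⇒L<n N p L hi

  edge-of-Mᵢ : ∀ {i u v} → 1 ≤ i → i ≤ 2 ^ M' → InMi m i u v → MatchedEdge u v
  edge-of-Mᵢ {suc t} _ 1+t≤2^M' (_ , _ , _ , _ , A∈H , B∈H , lo , hi , inj₁ (refl , refl)) =
    form-edge br-bracket (2[1+t]≡2+2t t) A∈H B∈H (odd-2* t) (2t<N 1+t≤2^M') lo hi
  edge-of-Mᵢ {suc t} _ 1+t≤2^M' (_ , _ , _ , _ , A∈H , B∈H , lo , hi , inj₂ (refl , refl)) =
    form-edge cbar-br-bracket (2[1+t]≡2+2t t) A∈H B∈H (odd-2* t) (2t<N 1+t≤2^M') lo hi

lemma5p4 : (m : ℕ) → 2 ≤ m → IsMatching m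
lemma5p4 (suc (suc M')) (s≤s (s≤s z≤n)) u v u' v' (_ , 1≤i , i≤2^M' , uv∈Mᵢ) (_ , 1≤i' , i'≤2^M' , u'v'∈Mᵢ') =
  shared-vertex (edge-of-Mᵢ 1≤i i≤2^M' uv∈Mᵢ) (edge-of-Mᵢ 1≤i' i'≤2^M' u'v'∈Mᵢ')
  where open Matching M'
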